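{- If $T$ is a regular tournament with $\gamma(T)\geq 4$, then $T$ is quadrangular.
   Context: A tournament is a loopless digraph in which for each pair of distinct vertices exactly one of $(u,v)$, $(v,u)$ is an arc; it is regular if all vertices have equal out-degree. $O(v)$ is the set of vertices $v$ beats and $I(v)$ the set of vertices beating $v$. A digraph is quadrangular if for all distinct $u,v$, $|O(u)\cap O(v)|\neq 1$ and $|I(u)\cap I(v)|\neq 1$. A dominating set of $T$ is a set $S$ of vertices such that every vertex is in $S$ or dominated by some vertex of $S$; $\gamma(T)$ is the minimum size of a dominating set. -}

module Defs where

open import Data.Nat using (ℕ; _≤_)
open import Data.Bool using (Bool; true; false; _∧_)
open import Data.Fin using (Fin)
open import Data.Fin.Subset using (Subset; _∈_; ∣_∣; inside; outside)
open import Data.Vec using (tabulate; lookup)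
open import Data.Product using (Σ; _×_; ∃)
open import Data.Sum using (_⊎_)
open import Relation.Binary.PropositionalEquality using (_≡_; _≢_)

-- A digraph on the vertex set Fin n, given by its (decidable) arc relation:
-- arc u v ≡ true  means (u , v) is an arc, i.e. u beats / dominates v.
Digraph : ℕ → Set
Digraph n = Fin n → Fin n → Bool

record IsTournament {n : ℕ} (A : Digraph n) : Set where
  field
    loopless   : ∀ u → A u u ≡ false
    total      : ∀ u v → u ≢ v → A u v ≡ true ⊎ A v u ≡ true
    asymmetric : ∀ u v → A u v ≡ true → A v u ≡ false

Out : ∀ {n} → Digraph n → Fin n → Subset n
Out A v = tabulate (λ w → A v w)

In : ∀ {n} → Digraph n → Fin n → Subset n
In A v = tabulate (λ w → A w v)

IsRegular : ∀ {n} → Digraph n → Set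
IsRegular {n} A = ∀ u v → ∣ Out A u ∣ ≡ ∣ Out A v ∣

_∩′_ : ∀ {n} → Subset n → Subset n → Subset n
_∩′_ p q = tabulate (λ i → lookup p i ∧ lookup q i)

IsQuadrangular : ∀ {n} → Digraph n → Set
IsQuadrangular A =
  ∀ u v → u ≢ v → (∣ Out A u ∩′ Out A v ∣ ≢ 1) × (∣ In A u ∩′ In A v ∣ ≢ 1)

IsDominating : ∀ {n} → Digraph n → Subset n → Set
IsDominating A S = ∀ v → v ∈ S ⊎ ∃ (λ s → s ∈ S × A s v ≡ true)

-- γ(T) ≥ k : every dominating set has at least k vertices.
-- (A dominating set always exists, e.g. all of V, so γ is well defined.)
DomNumber≥ : ∀ {n} → Digraph n → ℕ → Set
DomNumber≥ A k = ∀ S → IsDominating A S → k ≤ ∣ S ∣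

{-# OPTIONS --safe #-}
-- In a regular tournament every vertex has in-degree equal to its out-degree k
-- (double counting the arcs gives n·in = n·k). If v beats u, sorting the
-- vertices by how they relate to u and v gives
--   |O(u)| + |I(u) ∩ I(v)| = |I(v)| + |O(u) ∩ O(v)|,
-- so the common out- and in-neighbourhoods of any two vertices have the same
-- size. On the other hand {u, v} ∪ (I(u) ∩ I(v)) dominates any tournament, so
-- γ ≥ 4 forces |I(u) ∩ I(v)| ≥ 2, and then both intersections have size ≥ 2.
module Submission where

open import Defs
open import Data.Nat using (ℕ; zero; suc; _+_; _*_; _≤_; z≤n; s≤s)
open import Data.Nat.Properties
  using (≤-refl; ≤-trans; +-mono-≤; +-monoʳ-≤; +-cancelˡ-≤; +-cancelˡ-≡; *-cancelˡ-≡;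
         *-identityʳ; *-zeroʳ; suc-injective; >⇒≢; +-0-commutativeMonoid; module ≤-Reasoning)
open import Data.Bool using (Bool; true; false; not; _∧_; _∨_)
open import Data.Bool.Properties using (∧-comm; ∨-zeroʳ)
open import Data.Fin using (Fin; zero; suc)
open import Data.Fin.Properties using (_≟_; nonZeroIndex)
open import Data.Fin.Subset using (Subset; _∈_; ∣_∣)
open import Data.Vec using (tabulate; lookup)
open import Data.Vec.Properties using (lookup∘tabulate; lookup⇒[]=; tabulate-cong)
open import Data.Product using (_,_)
open import Data.Sum using (inj₁; inj₂)
open import Function using (_∘_)
open import Relation.Nullary.Decidable using (yes; no; does; dec-true)
open import Relation.Binary.PropositionalEquality
open import Algebra.Properties.CommutativeMonoid.Sum +-0-commutativeMonoid
  using (sum-syntax; sum-cong-≗; ∑-distrib-+; ∑-comm)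

χ : Bool → ℕ
χ true  = 1
χ false = 0

χ-∨-≤ : ∀ a b → χ (a ∨ b) ≤ χ a + χ b
χ-∨-≤ true  b = s≤s z≤n
χ-∨-≤ false b = ≤-refl

∑-const : ∀ n c → ∑[ i < n ] c ≡ n * c
∑-const zero    c = refl
∑-const (suc n) c = cong (c +_) (∑-const n c)

∑-mono-≤ : ∀ {n} {f g : Fin n → ℕ} → (∀ i → f i ≤ g i) → ∑[ i < n ] f i ≤ ∑[ i < n ] g i
∑-mono-≤ {zero}  f≤g = z≤n
∑-mono-≤ {suc n} f≤g = +-mono-≤ (f≤g zero) (∑-mono-≤ (f≤g ∘ suc))

-- does, unlike ⌊_⌋ = isYes, computes on suc i ≟ suc v.
∑-δ : ∀ {n} (v : Fin n) → ∑[ i < n ] χ (does (i ≟ v)) ≡ 1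
∑-δ {suc n} zero    = cong suc (trans (∑-const n 0) (*-zeroʳ n))
∑-δ {suc n} (suc v) = ∑-δ {n} v

∣tabulate∣≡∑ : ∀ {n} (p : Fin n → Bool) → ∣ tabulate p ∣ ≡ ∑[ i < n ] χ (p i)
∣tabulate∣≡∑ {zero}  p = refl
∣tabulate∣≡∑ {suc n} p with p zero
... | true  = cong suc (∣tabulate∣≡∑ (p ∘ suc))
... | false = ∣tabulate∣≡∑ (p ∘ suc)

∣tabulate∩′tabulate∣≡∑ : ∀ {n} (p q : Fin n → Bool) →
                         ∣ tabulate p ∩′ tabulate q ∣ ≡ ∑[ i < n ] χ (p i ∧ q i)
∣tabulate∩′tabulate∣≡∑ {n} p q = trans (∣tabulate∣≡∑ {n} _) (sum-cong-≗ {n} λ i →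
  cong₂ (λ a b → χ (a ∧ b)) (lookup∘tabulate p i) (lookup∘tabulate q i))

∈-tabulate⁺ : ∀ {n} (p : Fin n → Bool) {i} → p i ≡ true → i ∈ tabulate p
∈-tabulate⁺ p {i} pi = lookup⇒[]= i (tabulate p) (trans (lookup∘tabulate p i) pi)

∩′-comm : ∀ {n} (p q : Subset n) → p ∩′ q ≡ q ∩′ p
∩′-comm p q = tabulate-cong λ i → ∧-comm (lookup p i) (lookup q i)

∑∣Out∣≡∑∣In∣ : ∀ {n} (T : Digraph n) → ∑[ v < n ] ∣ Out T v ∣ ≡ ∑[ v < n ] ∣ In T v ∣
∑∣Out∣≡∑∣In∣ {n} T = begin
  ∑[ v < n ] ∣ Out T v ∣           ≡⟨ sum-cong-≗ {n} (∣tabulate∣≡∑ ∘ T) ⟩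
  ∑[ v < n ] ∑[ w < n ] χ (T v w)  ≡⟨ ∑-comm (λ v w → χ (T v w)) ⟩
  ∑[ w < n ] ∑[ v < n ] χ (T v w)  ≡⟨ sum-cong-≗ {n} (λ w → ∣tabulate∣≡∑ (λ v → T v w)) ⟨
  ∑[ w < n ] ∣ In T w ∣            ∎
  where open ≡-Reasoning

pair∪commonIn : ∀ {n} → Digraph n → Fin n → Fin n → Subset n
pair∪commonIn T u v = tabulate λ x → does (x ≟ u) ∨ does (x ≟ v) ∨ (T x u ∧ T x v)

module _ {n} {T : Digraph n} (tournament : IsTournament T) where
  open IsTournament tournament

  converse : ∀ {u v} → u ≢ v → T v u ≡ not (T u v)
  converse {u} {v} u≢v with total u v u≢v
  ... | inj₁ uv rewrite uv = asymmetric u v uv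
  ... | inj₂ vu rewrite vu | asymmetric v u vu = refl

  trichotomy : ∀ v x → χ (does (x ≟ v)) + χ (T v x) + χ (T x v) ≡ 1
  trichotomy v x with x ≟ v
  ... | yes refl rewrite loopless x = refl
  ... | no x≢v rewrite converse (x≢v ∘ sym) with T v x
  ...   | true  = refl
  ...   | false = refl

  1+∣Out∣+∣In∣≡n : ∀ v → 1 + ∣ Out T v ∣ + ∣ In T v ∣ ≡ n
  1+∣Out∣+∣In∣≡n v = begin
    1 + ∣ Out T v ∣ + ∣ In T v ∣
      ≡⟨ cong₂ _+_ (cong₂ _+_ (sym (∑-δ v)) (∣tabulate∣≡∑ {n} _)) (∣tabulate∣≡∑ {n} _) ⟩
    ∑[ x < n ] χ (does (x ≟ v)) + ∑[ x < n ] χ (T v x) + ∑[ x < n ] χ (T x v)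
      ≡⟨ cong (_+ ∑[ x < n ] χ (T x v)) (∑-distrib-+ {n} _ _) ⟨
    ∑[ x < n ] (χ (does (x ≟ v)) + χ (T v x)) + ∑[ x < n ] χ (T x v)
      ≡⟨ ∑-distrib-+ {n} _ _ ⟨
    ∑[ x < n ] (χ (does (x ≟ v)) + χ (T v x) + χ (T x v))
      ≡⟨ sum-cong-≗ {n} (trichotomy v) ⟩
    ∑[ x < n ] 1
      ≡⟨ ∑-const n 1 ⟩
    n * 1
      ≡⟨ *-identityʳ n ⟩
    n ∎
    where open ≡-Reasoning

  -- Because v beats u, both sides of the pointwise identity vanish at x = u
  -- and at x = v; for any other x it is a Boolean identity in (T u x, T v x).
  beaten⇒∣Out∣+∣In∩′In∣≡∣In∣+∣Out∩′Out∣ :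
    ∀ {u v} → T v u ≡ true →
    ∣ Out T u ∣ + ∣ In T u ∩′ In T v ∣ ≡ ∣ In T v ∣ + ∣ Out T u ∩′ Out T v ∣
  beaten⇒∣Out∣+∣In∩′In∣≡∣In∣+∣Out∩′Out∣ {u} {v} vu = begin
    ∣ Out T u ∣ + ∣ In T u ∩′ In T v ∣
      ≡⟨ cong₂ _+_ (∣tabulate∣≡∑ {n} _) (∣tabulate∩′tabulate∣≡∑ {n} _ _) ⟩
    ∑[ x < n ] χ (T u x) + ∑[ x < n ] χ (T x u ∧ T x v)
      ≡⟨ ∑-distrib-+ {n} _ _ ⟨
    ∑[ x < n ] (χ (T u x) + χ (T x u ∧ T x v))
      ≡⟨ sum-cong-≗ {n} pointwise ⟩
    ∑[ x < n ] (χ (T x v) + χ (T u x ∧ T v x))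
      ≡⟨ ∑-distrib-+ {n} _ _ ⟩
    ∑[ x < n ] χ (T x v) + ∑[ x < n ] χ (T u x ∧ T v x)
      ≡⟨ cong₂ _+_ (∣tabulate∣≡∑ {n} _) (∣tabulate∩′tabulate∣≡∑ {n} _ _) ⟨
    ∣ In T v ∣ + ∣ Out T u ∩′ Out T v ∣ ∎
    where
    open ≡-Reasoning
    pointwise : ∀ x → χ (T u x) + χ (T x u ∧ T x v) ≡ χ (T x v) + χ (T u x ∧ T v x)
    pointwise x with x ≟ u | x ≟ v
    ... | yes refl | _ rewrite loopless x | asymmetric v x vu = refl
    ... | no _ | yes refl rewrite loopless x | vu | asymmetric x u vu = refl
    ... | no x≢u | no x≢v
      rewrite converse (x≢u ∘ sym) | converse (x≢v ∘ sym) with T u x | T v x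
    ...   | true  | true  = refl
    ...   | true  | false = refl
    ...   | false | true  = refl
    ...   | false | false = refl

  pair∪commonIn-dominating : ∀ u v → IsDominating T (pair∪commonIn T u v)
  pair∪commonIn-dominating u v x with T u x in ux | T v x in vx
  ... | true  | _     = inj₂ (u , ∈-tabulate⁺ _ u∈ , ux)
    where
    u∈ : does (u ≟ u) ∨ does (u ≟ v) ∨ (T u u ∧ T u v) ≡ true
    u∈ rewrite dec-true (u ≟ u) refl = refl
  ... | false | true  = inj₂ (v , ∈-tabulate⁺ _ v∈ , vx)
    where
    v∈ : does (v ≟ u) ∨ does (v ≟ v) ∨ (T v u ∧ T v v) ≡ true
    v∈ rewrite dec-true (v ≟ v) refl = ∨-zeroʳ (does (v ≟ u))
  ... | false | false = inj₁ (∈-tabulate⁺ _ x∈)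
    where
    x∈ : does (x ≟ u) ∨ does (x ≟ v) ∨ (T x u ∧ T x v) ≡ true
    x∈ with x ≟ u | x ≟ v
    ... | yes _   | _       = refl
    ... | no _    | yes _   = refl
    ... | no x≢u | no x≢v
      rewrite converse (x≢u ∘ sym) | converse (x≢v ∘ sym) | ux | vx = refl

  ∣pair∪commonIn∣≤2+∣In∩′In∣ : ∀ u v → ∣ pair∪commonIn T u v ∣ ≤ 2 + ∣ In T u ∩′ In T v ∣
  ∣pair∪commonIn∣≤2+∣In∩′In∣ u v = begin
    ∣ pair∪commonIn T u v ∣
      ≡⟨ ∣tabulate∣≡∑ {n} _ ⟩
    ∑[ x < n ] χ (does (x ≟ u) ∨ does (x ≟ v) ∨ (T x u ∧ T x v))
      ≤⟨ ∑-mono-≤ (λ x → ≤-trans (χ-∨-≤ (does (x ≟ u)) _)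
                                  (+-monoʳ-≤ _ (χ-∨-≤ (does (x ≟ v)) _))) ⟩
    ∑[ x < n ] (χ (does (x ≟ u)) + (χ (does (x ≟ v)) + χ (T x u ∧ T x v)))
      ≡⟨ ∑-distrib-+ {n} _ _ ⟩
    ∑[ x < n ] χ (does (x ≟ u)) + ∑[ x < n ] (χ (does (x ≟ v)) + χ (T x u ∧ T x v))
      ≡⟨ cong (∑[ x < n ] χ (does (x ≟ u)) +_) (∑-distrib-+ {n} _ _) ⟩
    ∑[ x < n ] χ (does (x ≟ u)) + (∑[ x < n ] χ (does (x ≟ v)) + ∑[ x < n ] χ (T x u ∧ T x v))
      ≡⟨ cong₂ _+_ (∑-δ u) (cong₂ _+_ (∑-δ v) (sym (∣tabulate∩′tabulate∣≡∑ {n} _ _))) ⟩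
    1 + (1 + ∣ In T u ∩′ In T v ∣) ∎
    where open ≤-Reasoning

  DomNumber≥2+m⇒m≤∣In∩′In∣ : ∀ {m} → DomNumber≥ T (2 + m) → ∀ u v → m ≤ ∣ In T u ∩′ In T v ∣
  DomNumber≥2+m⇒m≤∣In∩′In∣ γ≥2+m u v = +-cancelˡ-≤ 2 _ _
    (≤-trans (γ≥2+m _ (pair∪commonIn-dominating u v)) (∣pair∪commonIn∣≤2+∣In∩′In∣ u v))

  module _ (regular : IsRegular T) where

    ∣In∣≡∣Out∣ : ∀ u v → ∣ In T v ∣ ≡ ∣ Out T u ∣
    ∣In∣≡∣Out∣ u v = *-cancelˡ-≡ _ _ n {{nonZeroIndex v}} (begin
      n * ∣ In T v ∣           ≡⟨ ∑-const n _ ⟨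
      ∑[ w < n ] ∣ In T v ∣    ≡⟨ sum-cong-≗ {n} ∣In∣-constant ⟨
      ∑[ w < n ] ∣ In T w ∣    ≡⟨ ∑∣Out∣≡∑∣In∣ T ⟨
      ∑[ w < n ] ∣ Out T w ∣   ≡⟨ sum-cong-≗ {n} (λ w → regular w u) ⟩
      ∑[ w < n ] ∣ Out T u ∣   ≡⟨ ∑-const n _ ⟩
      n * ∣ Out T u ∣          ∎)
      where
      open ≡-Reasoning
      ∣In∣-constant : ∀ w → ∣ In T w ∣ ≡ ∣ In T v ∣
      ∣In∣-constant w = +-cancelˡ-≡ ∣ Out T v ∣ _ _ (begin
        ∣ Out T v ∣ + ∣ In T w ∣  ≡⟨ cong (_+ _) (regular v w) ⟩
        ∣ Out T w ∣ + ∣ In T w ∣  ≡⟨ suc-injective (trans (1+∣Out∣+∣In∣≡n w)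
                                                          (sym (1+∣Out∣+∣In∣≡n v))) ⟩
        ∣ Out T v ∣ + ∣ In T v ∣  ∎)

    beaten⇒∣Out∩′Out∣≡∣In∩′In∣ :
      ∀ {u v} → T v u ≡ true → ∣ Out T u ∩′ Out T v ∣ ≡ ∣ In T u ∩′ In T v ∣
    beaten⇒∣Out∩′Out∣≡∣In∩′In∣ {u} {v} vu = sym (+-cancelˡ-≡ ∣ Out T u ∣ _ _
      (trans (beaten⇒∣Out∣+∣In∩′In∣≡∣In∣+∣Out∩′Out∣ vu)
             (cong (_+ ∣ Out T u ∩′ Out T v ∣) (∣In∣≡∣Out∣ u v))))

    ∣Out∩′Out∣≡∣In∩′In∣ : ∀ {u v} → u ≢ v → ∣ Out T u ∩′ Out T v ∣ ≡ ∣ In T u ∩′ In T v ∣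
    ∣Out∩′Out∣≡∣In∩′In∣ {u} {v} u≢v with total u v u≢v
    ... | inj₂ vu = beaten⇒∣Out∩′Out∣≡∣In∩′In∣ vu
    ... | inj₁ uv = begin
      ∣ Out T u ∩′ Out T v ∣  ≡⟨ cong ∣_∣ (∩′-comm (Out T u) (Out T v)) ⟩
      ∣ Out T v ∩′ Out T u ∣  ≡⟨ beaten⇒∣Out∩′Out∣≡∣In∩′In∣ uv ⟩
      ∣ In T v ∩′ In T u ∣    ≡⟨ cong ∣_∣ (∩′-comm (In T v) (In T u)) ⟩
      ∣ In T u ∩′ In T v ∣    ∎
      where open ≡-Reasoning

corollary17 : (n : ℕ) (T : Digraph n) → IsTournament T → IsRegular T →
              DomNumber≥ T 4 → IsQuadrangular T
corollary17 n T tournament regular γ≥4 u v u≢v =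
  >⇒≢ 2≤∣Out∩′Out∣ , >⇒≢ 2≤∣In∩′In∣
  where
  2≤∣In∩′In∣ : 2 ≤ ∣ In T u ∩′ In T v ∣
  2≤∣In∩′In∣ = DomNumber≥2+m⇒m≤∣In∩′In∣ tournament γ≥4 u v
  2≤∣Out∩′Out∣ : 2 ≤ ∣ Out T u ∩′ Out T v ∣
  2≤∣Out∩′Out∣ =
    subst (2 ≤_) (sym (∣Out∩′Out∣≡∣In∩′In∣ tournament regular u≢v)) 2≤∣In∩′In∣
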